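{- Let $G=(V,E)$ be a graph and $A_s,A_t\subseteq V$ independent offensive alliances with $|A_s|=|A_t|=k$. There is an independent offensive alliance TJ sequence from $A_s$ to $A_t$ if and only if there is an independent offensive alliance TAR sequence from $A_s$ to $A_t$ with threshold $k+1$.
   Context: For $A\subseteq V$: $\partial A=N(A)\setminus A$, $d_A(v)=|N(v)\cap A|$; $A$ is an offensive alliance if $d_A(v)\ge d_{V\setminus A}(v)+1$ for all $v\in\partial A$, and an independent offensive alliance if additionally it is an independent set. $B$ is obtained from $A$ by a token jumping (TJ) step if $|A|=|B|$ and $|A\setminus B|=1$; by a token addition/removal (TAR) step if one of $A,B$ arises from the other by adding exactly one vertex. An independent offensive alliance $Y$ sequence ($Y\in\{\text{TJ},\text{TAR}\}$) is a sequence $A_1,\dots,A_m$ of independent offensive alliances where each $A_{i+1}$ is obtained from $A_i$ by a $Y$ step; a TAR sequence has threshold $t$ if all its sets have size at most $t$. -}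

module Defs where

open import Data.Nat using (ℕ; suc; _+_; _≤_)
open import Data.Bool using (Bool; true; false)
open import Data.Fin using (Fin)
open import Data.Fin.Subset using (Subset; _∈_; _∉_; _∩_; _∪_; _─_; ∣_∣; ∁; ⁅_⁆)
open import Data.Vec using (tabulate)
open import Data.Product using (Σ; ∃; _×_; _,_)
open import Data.Sum using (_⊎_)
open import Relation.Binary.PropositionalEquality using (_≡_)
open import Relation.Nullary using (¬_)

record Graph (n : ℕ) : Set where
  field
    adj   : Fin n → Fin n → Bool
    sym   : ∀ u v → adj u v ≡ adj v u
    irrefl : ∀ v → adj v v ≡ false

module _ {n : ℕ} (G : Graph n) where
  open Graph G

  N : Fin n → Subset n
  N v = tabulate (adj v)

  Adj : Fin n → Fin n → Set
  Adj u v = adj u v ≡ true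

  deg : Subset n → Fin n → ℕ
  deg A v = ∣ N v ∩ A ∣

  InBoundary : Subset n → Fin n → Set
  InBoundary A v = v ∉ A × ∃ λ u → u ∈ A × Adj u v

  IsOffensiveAlliance : Subset n → Set
  IsOffensiveAlliance A = ∀ v → InBoundary A v → deg (∁ A) v + 1 ≤ deg A v

  IsIndependent : Subset n → Set
  IsIndependent A = ∀ u v → u ∈ A → v ∈ A → ¬ Adj u v

  IsIOA : Subset n → Set
  IsIOA A = IsIndependent A × IsOffensiveAlliance A

TJStep : ∀ {n} → Subset n → Subset n → Set
TJStep A B = ∣ A ∣ ≡ ∣ B ∣ × ∣ A ─ B ∣ ≡ 1

TARStep : ∀ {n} → Subset n → Subset n → Set
TARStep A B = (∃ λ v → v ∉ A × B ≡ A ∪ ⁅ v ⁆) ⊎ (∃ λ v → v ∉ B × A ≡ B ∪ ⁅ v ⁆)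

data Seq {n : ℕ} (R : Subset n → Subset n → Set) (P : Subset n → Set)
         : Subset n → Subset n → Set where
  single : ∀ {x} → P x → Seq R P x x
  step   : ∀ {x y z} → P x → R x y → Seq R P y z → Seq R P x z

Bounded : ∀ {n} → ℕ → Subset n → Set
Bounded t A = ∣ A ∣ ≤ t

IOA-TJ-Seq : ∀ {n} → Graph n → Subset n → Subset n → Set
IOA-TJ-Seq G = Seq TJStep (IsIOA G)

IOA-TAR-Seq : ∀ {n} → Graph n → ℕ → Subset n → Subset n → Set
IOA-TAR-Seq G t = Seq TARStep (λ A → IsIOA G A × Bounded t A)

-- A TJ step from C ∪ {u} to C ∪ {w} becomes two TAR steps: through C ∪ {u, w} when u and w
-- are non-adjacent (every member of it lies in one of the two given alliances), and through C
-- when u ~ w. In the latter case u is a leaf hanging from w: w is u's only neighbour in the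
-- offensive alliance C ∪ {w} and must outnumber all its other neighbours, so there are none.
--
-- Conversely, along a TAR sequence of threshold k + 1 the current set D stays anchored at some
-- TJ-reachable k-set S: either D ⊆ S and every set between D and S is an independent offensive
-- alliance, or S ⊆ D and |D| = k + 1. Removing a token preserves this (one TJ step in the second
-- case); adding u ∉ S to D below S is matched by the TJ step S → S - w + u, where w is u's
-- neighbour in S, which is unique by the leaf argument, or any vertex of S - D if u has none.

module Submission where

open import Defs
open import Data.Nat using (ℕ; suc; _+_; _≤_; _<_)
open import Data.Nat.Properties
  using ( ≤-refl; ≤-trans; ≤-reflexive; +-comm; +-monoˡ-≤; m≤m+n; n≤1+n; 1+n≢n; 1+n≰n; <⇒≱
        ; suc-injective )
open import Data.Bool using (true)
import Data.Bool as Bool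
open import Data.Fin using (Fin; zero; suc)
open import Data.Fin.Properties using (any?) renaming (_≟_ to _≟ᶠ_)
open import Data.Fin.Subset
  using (Subset; _∈_; _∉_; _⊆_; _∩_; _∪_; _─_; _-_; ∣_∣; ∁; ⁅_⁆; inside; outside)
  renaming (⊥ to ∅)
open import Data.Fin.Subset.Properties
  using ( ⊆-antisym; ⊆-refl; p⊆q⇒∣p∣≤∣q∣; p⊂q⇒∣p∣<∣q∣; x∈⁅x⁆; x∈⁅y⁆⇒x≡y; ∣⁅x⁆∣≡1; _∈?_
        ; x∈p∩q⁺; x∈p∩q⁻; x∈p∪q⁺; x∈p∪q⁻; p⊆p∪q; x∈p∧x∉q⇒x∈p─q; x∈p∧x≢y⇒x∈p-y
        ; x∈∁p⇒x∉p; x∉p⇒x∈∁p; ∪-assoc; ∪-comm; ∪-identityʳ; ∣⊥∣≡0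
        ; p∩q⊆p; p∩q⊆q; p─q⊆p )
open import Data.Vec using (_∷_; here; there)
open import Data.Vec.Properties using (lookup∘tabulate; []=⇒lookup; lookup⇒[]=)
open import Data.Product using (∃; ∃₂; _×_; _,_; proj₁; proj₂)
open import Data.Sum using (_⊎_; inj₁; inj₂; [_,_]′)
import Data.Sum as Sum
open import Data.Empty using (⊥-elim)
open import Relation.Nullary using (¬_; Dec; yes; no; ¬?)
open import Relation.Nullary.Decidable using (_×-dec_)
open import Relation.Binary.PropositionalEquality

private variable
  n : ℕ
  p q r : Subset n
  x y : Fin n
  R : Subset n → Subset n → Set
  P : Subset n → Set

x∈p∪⁅y⁆⁻ : ∀ (p : Subset n) → x ∈ p ∪ ⁅ y ⁆ → x ∈ p ⊎ x ≡ y
x∈p∪⁅y⁆⁻ {y = y} p x∈ = Sum.map₂ (x∈⁅y⁆⇒x≡y y) (x∈p∪q⁻ p ⁅ y ⁆ x∈)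

x∈p∪⁅x⁆ : x ∈ p ∪ ⁅ x ⁆
x∈p∪⁅x⁆ {x = x} = x∈p∪q⁺ (inj₂ (x∈⁅x⁆ x))

p∪⁅x⁆⊆q : p ⊆ q → x ∈ q → p ∪ ⁅ x ⁆ ⊆ q
p∪⁅x⁆⊆q {p = p} p⊆q x∈q y∈ = [ p⊆q , (λ { refl → x∈q }) ]′ (x∈p∪⁅y⁆⁻ p y∈)

⁅x⁆⊆p : x ∈ p → ⁅ x ⁆ ⊆ p
⁅x⁆⊆p {x = x} x∈p y∈ rewrite x∈⁅y⁆⇒x≡y x y∈ = x∈p

x∈p─q⇒x∉q : ∀ (p q : Subset n) → x ∈ p ─ q → x ∉ q
-- At the head, x ∈ q forces x ∉ p ─ q, so only the tail case remains.
x∈p─q⇒x∉q (_ ∷ p) (_ ∷ q) (there x∈) (there x∈q) = x∈p─q⇒x∉q p q x∈ x∈q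

∃∈q∉p⊎q⊆p : ∀ (p q : Subset n) → (∃ λ x → x ∈ q × x ∉ p) ⊎ q ⊆ p
∃∈q∉p⊎q⊆p p q with any? (λ x → (x ∈? q) ×-dec ¬? (x ∈? p))
... | yes witness = inj₁ witness
... | no  none    = inj₂ q⊆p
  where
  q⊆p : q ⊆ p
  q⊆p {x} x∈q with x ∈? p
  ... | yes x∈p = x∈p
  ... | no  x∉p = ⊥-elim (none (x , x∈q , x∉p))

p⊆q∧∣q∣≤∣p∣⇒p≡q : p ⊆ q → ∣ q ∣ ≤ ∣ p ∣ → p ≡ q
p⊆q∧∣q∣≤∣p∣⇒p≡q {p = p} {q = q} p⊆q ∣q∣≤∣p∣ with ∃∈q∉p⊎q⊆p p q
... | inj₁ (x , x∈q , x∉p) = ⊥-elim (<⇒≱ (p⊂q⇒∣p∣<∣q∣ (p⊆q , x , x∈q , x∉p)) ∣q∣≤∣p∣)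
... | inj₂ q⊆p             = ⊆-antisym p⊆q q⊆p

∣p∣<∣q∣⇒∃∈q∉p : ∣ p ∣ < ∣ q ∣ → ∃ λ x → x ∈ q × x ∉ p
∣p∣<∣q∣⇒∃∈q∉p {p = p} {q = q} ∣p∣<∣q∣ with ∃∈q∉p⊎q⊆p p q
... | inj₁ witness = witness
... | inj₂ q⊆p     = ⊥-elim (<⇒≱ ∣p∣<∣q∣ (p⊆q⇒∣p∣≤∣q∣ q⊆p))

∣p∣≡1⇒p≡⁅x⁆ : ∣ p ∣ ≡ 1 → ∃ λ x → p ≡ ⁅ x ⁆
∣p∣≡1⇒p≡⁅x⁆ {n} {p} ∣p∣≡1
  with ∣p∣<∣q∣⇒∃∈q∉p {p = ∅} {q = p} (subst₂ _<_ (sym (∣⊥∣≡0 n)) (sym ∣p∣≡1) ≤-refl)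
... | x , x∈p , _ =
  x , sym (p⊆q∧∣q∣≤∣p∣⇒p≡q (⁅x⁆⊆p x∈p) (≤-reflexive (trans ∣p∣≡1 (sym (∣⁅x⁆∣≡1 x)))))

∣p∪⁅x⁆∣≡1+∣p∣ : ∀ p → x ∉ p → ∣ p ∪ ⁅ x ⁆ ∣ ≡ suc ∣ p ∣
∣p∪⁅x⁆∣≡1+∣p∣ {x = zero}  (inside  ∷ p) x∉ = ⊥-elim (x∉ here)
∣p∪⁅x⁆∣≡1+∣p∣ {x = zero}  (outside ∷ p) _  = cong (λ q → suc ∣ q ∣) (∪-identityʳ p)
∣p∪⁅x⁆∣≡1+∣p∣ {x = suc x} (inside  ∷ p) x∉ = cong suc (∣p∪⁅x⁆∣≡1+∣p∣ p (λ x∈ → x∉ (there x∈)))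
∣p∪⁅x⁆∣≡1+∣p∣ {x = suc x} (outside ∷ p) x∉ = ∣p∪⁅x⁆∣≡1+∣p∣ p (λ x∈ → x∉ (there x∈))

p-x∪⁅x⁆≡p : x ∈ p → (p - x) ∪ ⁅ x ⁆ ≡ p
p-x∪⁅x⁆≡p {x = x} {p = p} x∈p = ⊆-antisym (p∪⁅x⁆⊆q (p─q⊆p p ⁅ x ⁆) x∈p) p⊆
  where
  p⊆ : p ⊆ (p - x) ∪ ⁅ x ⁆
  p⊆ {y} y∈p with y ≟ᶠ x
  ... | yes refl = x∈p∪⁅x⁆
  ... | no  y≢x  = p⊆p∪q ⁅ x ⁆ (x∈p∧x≢y⇒x∈p-y y∈p y≢x)

1+∣p-x∣≡∣p∣ : x ∈ p → suc ∣ p - x ∣ ≡ ∣ p ∣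
1+∣p-x∣≡∣p∣ {x = x} {p = p} x∈p = begin
  suc ∣ p - x ∣      ≡⟨ sym (∣p∪⁅x⁆∣≡1+∣p∣ (p - x) (λ x∈ → x∈p─q⇒x∉q p ⁅ x ⁆ x∈ (x∈⁅x⁆ x))) ⟩
  ∣ (p - x) ∪ ⁅ x ⁆ ∣  ≡⟨ cong ∣_∣ (p-x∪⁅x⁆≡p x∈p) ⟩
  ∣ p ∣              ∎
  where open ≡-Reasoning

p─q≡⁅x⁆⇒p≡p∩q∪⁅x⁆ : p ─ q ≡ ⁅ x ⁆ → p ≡ p ∩ q ∪ ⁅ x ⁆
p─q≡⁅x⁆⇒p≡p∩q∪⁅x⁆ {p = p} {q = q} {x = x} p─q≡⁅x⁆ =
  ⊆-antisym p⊆ (p∪⁅x⁆⊆q (p∩q⊆p p q) (p─q⊆p p q (subst (x ∈_) (sym p─q≡⁅x⁆) (x∈⁅x⁆ x))))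
  where
  p⊆ : p ⊆ p ∩ q ∪ ⁅ x ⁆
  p⊆ {z} z∈p with z ∈? q
  ... | yes z∈q = p⊆p∪q ⁅ x ⁆ (x∈p∩q⁺ (z∈p , z∈q))
  ... | no  z∉q rewrite x∈⁅y⁆⇒x≡y x (subst (z ∈_) p─q≡⁅x⁆ (x∈p∧x∉q⇒x∈p─q z∈p z∉q)) = x∈p∪⁅x⁆

p⊆q∧1+∣p∣≡∣q∣⇒q≡p∪⁅y⁆ : p ⊆ q → suc ∣ p ∣ ≡ ∣ q ∣ → ∃ λ y → y ∉ p × q ≡ p ∪ ⁅ y ⁆
p⊆q∧1+∣p∣≡∣q∣⇒q≡p∪⁅y⁆ {p = p} {q = q} p⊆q 1+∣p∣≡∣q∣ with ∣p∣<∣q∣⇒∃∈q∉p (≤-reflexive 1+∣p∣≡∣q∣)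
... | y , y∈q , y∉p = y , y∉p , sym (p⊆q∧∣q∣≤∣p∣⇒p≡q (p∪⁅x⁆⊆q p⊆q y∈q) ∣q∣≤)
  where
  ∣q∣≤ : ∣ q ∣ ≤ ∣ p ∪ ⁅ y ⁆ ∣
  ∣q∣≤ = ≤-reflexive (trans (sym 1+∣p∣≡∣q∣) (sym (∣p∪⁅x⁆∣≡1+∣p∣ p y∉p)))

tjStep⁺ : ∣ p ∣ ≡ ∣ q ∣ → x ∈ p → x ∉ q → p ⊆ q ∪ ⁅ x ⁆ → TJStep p q
tjStep⁺ {p = p} {q = q} {x = x} ∣p∣≡∣q∣ x∈p x∉q p⊆ = ∣p∣≡∣q∣ , trans (cong ∣_∣ p─q≡⁅x⁆) (∣⁅x⁆∣≡1 x)
  where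
  p─q⊆⁅x⁆ : p ─ q ⊆ ⁅ x ⁆
  p─q⊆⁅x⁆ {y} y∈ with x∈p∪⁅y⁆⁻ q (p⊆ (p─q⊆p p q y∈))
  ... | inj₁ y∈q = ⊥-elim (x∈p─q⇒x∉q p q y∈ y∈q)
  ... | inj₂ refl = x∈⁅x⁆ x
  p─q≡⁅x⁆ : p ─ q ≡ ⁅ x ⁆
  p─q≡⁅x⁆ = ⊆-antisym p─q⊆⁅x⁆ (⁅x⁆⊆p (x∈p∧x∉q⇒x∈p─q x∈p x∉q))

tjStep-exchange : x ∈ p → y ∉ p → TJStep p ((p - x) ∪ ⁅ y ⁆)
tjStep-exchange {x = x} {p = p} {y = y} x∈p y∉p =
  tjStep⁺ (sym ∣p′∣≡∣p∣) x∈p x∉p′ p⊆p′∪⁅x⁆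
  where
  p′ : Subset _
  p′ = (p - x) ∪ ⁅ y ⁆
  ∣p′∣≡∣p∣ : ∣ p′ ∣ ≡ ∣ p ∣
  ∣p′∣≡∣p∣ = trans (∣p∪⁅x⁆∣≡1+∣p∣ (p - x) (λ y∈ → y∉p (p─q⊆p p ⁅ x ⁆ y∈))) (1+∣p-x∣≡∣p∣ x∈p)
  x∉p′ : x ∉ p′
  x∉p′ x∈ with x∈p∪⁅y⁆⁻ (p - x) x∈
  ... | inj₁ x∈p-x = x∈p─q⇒x∉q p ⁅ x ⁆ x∈p-x (x∈⁅x⁆ x)
  ... | inj₂ refl  = y∉p x∈p
  p⊆p′∪⁅x⁆ : p ⊆ p′ ∪ ⁅ x ⁆
  p⊆p′∪⁅x⁆ {z} z∈p with z ≟ᶠ x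
  ... | yes refl = x∈p∪⁅x⁆
  ... | no  z≢x  = p⊆p∪q ⁅ x ⁆ (p⊆p∪q ⁅ y ⁆ (x∈p∧x≢y⇒x∈p-y z∈p z≢x))

tjStep-split : TJStep p q →
  ∃ λ r → ∃₂ λ x y → x ∉ r × y ∉ r × x ≢ y × p ≡ r ∪ ⁅ x ⁆ × q ≡ r ∪ ⁅ y ⁆
tjStep-split {p = p} {q = q} (∣p∣≡∣q∣ , ∣p─q∣≡1) with ∣p∣≡1⇒p≡⁅x⁆ ∣p─q∣≡1
... | x , p─q≡⁅x⁆ = result
  where
  x∉q : x ∉ q
  x∉q = x∈p─q⇒x∉q p q (subst (x ∈_) (sym p─q≡⁅x⁆) (x∈⁅x⁆ x))
  x∉p∩q : x ∉ p ∩ q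
  x∉p∩q x∈ = x∉q (p∩q⊆q p q x∈)
  p≡ : p ≡ p ∩ q ∪ ⁅ x ⁆
  p≡ = p─q≡⁅x⁆⇒p≡p∩q∪⁅x⁆ p─q≡⁅x⁆
  1+∣p∩q∣≡∣q∣ : suc ∣ p ∩ q ∣ ≡ ∣ q ∣
  1+∣p∩q∣≡∣q∣ = trans (sym (∣p∪⁅x⁆∣≡1+∣p∣ (p ∩ q) x∉p∩q)) (trans (cong ∣_∣ (sym p≡)) ∣p∣≡∣q∣)
  result : ∃ λ r → ∃₂ λ x y → x ∉ r × y ∉ r × x ≢ y × p ≡ r ∪ ⁅ x ⁆ × q ≡ r ∪ ⁅ y ⁆
  result with p⊆q∧1+∣p∣≡∣q∣⇒q≡p∪⁅y⁆ (p∩q⊆q p q) 1+∣p∩q∣≡∣q∣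
  ... | y , y∉p∩q , q≡ =
    p ∩ q , x , y , x∉p∩q , y∉p∩q , (λ { refl → x∉q (subst (x ∈_) (sym q≡) x∈p∪⁅x⁆) }) , p≡ , q≡

first : Seq R P p q → P p
first (single Pp)   = Pp
first (step Pp _ _) = Pp

last : Seq R P p q → P q
last (single Pq)  = Pq
last (step _ _ s) = last s

_++ˢ_ : Seq R P p q → Seq R P q r → Seq R P p r
single _     ++ˢ t = t
step Pp pRq s ++ˢ t = step Pp pRq (s ++ˢ t)

snoc : Seq R P p q → R q r → P r → Seq R P p r
snoc s qRr Pr = s ++ˢ step (last s) qRr (single Pr)

module _ {n : ℕ} (G : Graph n) where

  private variable
    A B C D S X : Subset n
    u v w : Fin n

  Adj? : ∀ u v → Dec (Adj G u v)
  Adj? u v = Graph.adj G u v Bool.≟ true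

  Adj-sym : Adj G u v → Adj G v u
  Adj-sym {u} {v} u~v = trans (Graph.sym G v u) u~v

  Adj-irrefl : ¬ Adj G v v
  Adj-irrefl {v} v~v with trans (sym v~v) (Graph.irrefl G v)
  ... | ()

  ∈N⁺ : Adj G v u → u ∈ N G v
  ∈N⁺ {v} {u} v~u = lookup⇒[]= u (N G v) (trans (lookup∘tabulate (Graph.adj G v) u) v~u)

  ∈N⁻ : u ∈ N G v → Adj G v u
  ∈N⁻ {u} {v} u∈N = trans (sym (lookup∘tabulate (Graph.adj G v) u)) ([]=⇒lookup u∈N)

  deg-mono : (∀ z → Adj G v z → z ∈ A → z ∈ B) → deg G A v ≤ deg G B v
  deg-mono {v} {A} {B} N∩A⊆B = p⊆q⇒∣p∣≤∣q∣ λ {z} z∈ →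
    let (z∈N , z∈A) = x∈p∩q⁻ (N G v) A z∈ in x∈p∩q⁺ (z∈N , N∩A⊆B z (∈N⁻ z∈N) z∈A)

  Overpowers : Subset n → Fin n → Set
  Overpowers A v = deg G (∁ A) v + 1 ≤ deg G A v

  overpowers-transfer : (∀ z → Adj G v z → z ∈ A → z ∈ B) → Overpowers A v → Overpowers B v
  overpowers-transfer {v} {A} {B} N∩A⊆B A-wins =
    ≤-trans (+-monoˡ-≤ 1 (deg-mono N∖B⊆∖A)) (≤-trans A-wins (deg-mono N∩A⊆B))
    where
    N∖B⊆∖A : ∀ z → Adj G v z → z ∈ ∁ B → z ∈ ∁ A
    N∖B⊆∖A z v~z z∈∁B = x∉p⇒x∈∁p (λ z∈A → x∈∁p⇒x∉p z∈∁B (N∩A⊆B z v~z z∈A))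

  unique-attacker⇒unique-neighbour : IsOffensiveAlliance G A → InBoundary G A v →
    (∀ z → Adj G v z → z ∈ A → z ≡ w) → ∀ z → Adj G v z → z ≡ w
  unique-attacker⇒unique-neighbour {A} {v} {w} offA ∂v only-w z v~z with z ∈? A
  ... | yes z∈A = only-w z v~z z∈A
  ... | no  z∉A = ⊥-elim (1+n≰n (≤-trans (+-monoˡ-≤ 1 1≤deg∁) (≤-trans (offA v ∂v) deg≤1)))
    where
    1≤deg∁ : 1 ≤ deg G (∁ A) v
    1≤deg∁ = subst (_≤ deg G (∁ A) v) (∣⁅x⁆∣≡1 z)
      (p⊆q⇒∣p∣≤∣q∣ (⁅x⁆⊆p (x∈p∩q⁺ (∈N⁺ v~z , x∉p⇒x∈∁p z∉A))))
    deg≤1 : deg G A v ≤ 1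
    deg≤1 = subst (deg G A v ≤_) (∣⁅x⁆∣≡1 w) (p⊆q⇒∣p∣≤∣q∣ λ {y} y∈ →
      let (y∈N , y∈A) = x∈p∩q⁻ (N G v) A y∈ in
      subst (_∈ ⁅ w ⁆) (sym (only-w y (∈N⁻ y∈N) y∈A)) (x∈⁅x⁆ w))

  independent-⊆ : A ⊆ B → IsIndependent G B → IsIndependent G A
  independent-⊆ A⊆B indB a b a∈A b∈A = indB a b (A⊆B a∈A) (A⊆B b∈A)

  independent-∪⁅⁆ : IsIndependent G A → (∀ z → z ∈ A → ¬ Adj G z v) → IsIndependent G (A ∪ ⁅ v ⁆)
  independent-∪⁅⁆ {A} indA v-isolated a b a∈ b∈ with x∈p∪⁅y⁆⁻ A a∈ | x∈p∪⁅y⁆⁻ A b∈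
  ... | inj₁ a∈A | inj₁ b∈A = indA a b a∈A b∈A
  ... | inj₁ a∈A | inj₂ refl = v-isolated a a∈A
  ... | inj₂ refl | inj₁ b∈A = λ a~b → v-isolated b b∈A (Adj-sym a~b)
  ... | inj₂ refl | inj₂ refl = Adj-irrefl

  offensive-cover : (∀ c → c ∈ X → ∃ λ A → c ∈ A × A ⊆ X × IsOffensiveAlliance G A) →
    IsOffensiveAlliance G X
  offensive-cover cover v (v∉X , c , c∈X , c~v) with cover c c∈X
  ... | A , c∈A , A⊆X , offA =
    overpowers-transfer (λ _ _ → A⊆X) (offA v ((λ v∈A → v∉X (A⊆X v∈A)) , c , c∈A , c~v))

  ioa-join : ¬ Adj G u w → IsIOA G (C ∪ ⁅ u ⁆) → IsIOA G (C ∪ ⁅ w ⁆) →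
    IsIOA G ((C ∪ ⁅ u ⁆) ∪ ⁅ w ⁆)
  ioa-join {u} {w} {C} u≁w (indCu , offCu) (indCw , offCw) =
    independent-∪⁅⁆ indCu w-isolated , offensive-cover cover
    where
    w-isolated : ∀ z → z ∈ C ∪ ⁅ u ⁆ → ¬ Adj G z w
    w-isolated z z∈ with x∈p∪⁅y⁆⁻ C z∈
    ... | inj₁ z∈C  = indCw z w (p⊆p∪q ⁅ w ⁆ z∈C) x∈p∪⁅x⁆
    ... | inj₂ refl = u≁w
    Cw⊆Cuw : C ∪ ⁅ w ⁆ ⊆ (C ∪ ⁅ u ⁆) ∪ ⁅ w ⁆
    Cw⊆Cuw = p∪⁅x⁆⊆q (λ c∈C → p⊆p∪q ⁅ w ⁆ (p⊆p∪q ⁅ u ⁆ c∈C)) x∈p∪⁅x⁆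
    cover : ∀ c → c ∈ (C ∪ ⁅ u ⁆) ∪ ⁅ w ⁆ →
      ∃ λ A → c ∈ A × A ⊆ (C ∪ ⁅ u ⁆) ∪ ⁅ w ⁆ × IsOffensiveAlliance G A
    cover c c∈ with x∈p∪⁅y⁆⁻ (C ∪ ⁅ u ⁆) c∈
    ... | inj₁ c∈Cu = C ∪ ⁅ u ⁆ , c∈Cu , p⊆p∪q ⁅ w ⁆ , offCu
    ... | inj₂ refl = C ∪ ⁅ w ⁆ , x∈p∪⁅x⁆ , Cw⊆Cuw , offCw

  -- u is a leaf hanging from w, and w has no neighbour in C; so no boundary vertex of C
  -- is adjacent to u.
  ioa-meet : u ∉ C → w ∉ C → u ≢ w → Adj G u w →
    IsIOA G (C ∪ ⁅ u ⁆) → IsIOA G (C ∪ ⁅ w ⁆) → IsIOA G C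
  ioa-meet {u} {C} {w} u∉C w∉C u≢w u~w (indCu , offCu) (indCw , offCw) =
    independent-⊆ (p⊆p∪q ⁅ u ⁆) indCu , offC
    where
    u∉Cw : u ∉ C ∪ ⁅ w ⁆
    u∉Cw u∈ = [ u∉C , u≢w ]′ (x∈p∪⁅y⁆⁻ C u∈)
    only-w : ∀ z → Adj G u z → z ∈ C ∪ ⁅ w ⁆ → z ≡ w
    only-w z u~z z∈ with x∈p∪⁅y⁆⁻ C z∈
    ... | inj₁ z∈C  = ⊥-elim (indCu u z x∈p∪⁅x⁆ (p⊆p∪q ⁅ u ⁆ z∈C) u~z)
    ... | inj₂ z≡w  = z≡w
    u-leaf : ∀ z → Adj G u z → z ≡ w
    u-leaf = unique-attacker⇒unique-neighbour offCw (u∉Cw , w , x∈p∪⁅x⁆ , Adj-sym u~w) only-w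
    offC : IsOffensiveAlliance G C
    offC v (v∉C , c , c∈C , c~v) =
      overpowers-transfer N∩Cu⊆C (offCu v (v∉Cu , c , p⊆p∪q ⁅ u ⁆ c∈C , c~v))
      where
      v∉Cu : v ∉ C ∪ ⁅ u ⁆
      v∉Cu v∈ = indCu c v (p⊆p∪q ⁅ u ⁆ c∈C) v∈ c~v
      N∩Cu⊆C : ∀ z → Adj G v z → z ∈ C ∪ ⁅ u ⁆ → z ∈ C
      N∩Cu⊆C z v~z z∈ with x∈p∪⁅y⁆⁻ C z∈
      ... | inj₁ z∈C  = z∈C
      ... | inj₂ refl = ⊥-elim (indCw c w (p⊆p∪q ⁅ w ⁆ c∈C) x∈p∪⁅x⁆
                                  (subst (Adj G c) (u-leaf v (Adj-sym v~z)) c~v))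

  -- A boundary vertex v of X not adjacent to u is outnumbered as it is for X ∪ ⁅u⁆, and one
  -- with a neighbour in D as it is for D; otherwise u would be v's only neighbour, yet c ≠ u.
  offensive-drop : D ⊆ X → u ∉ X → IsIOA G (X ∪ ⁅ u ⁆) →
    IsOffensiveAlliance G (D ∪ ⁅ u ⁆) → IsOffensiveAlliance G D → IsOffensiveAlliance G X
  offensive-drop {D} {X} {u} D⊆X u∉X (indXu , offXu) offDu offD v (v∉X , c , c∈X , c~v) =
    by-cases (Adj? u v)
    where
    v∉Xu : v ∉ X ∪ ⁅ u ⁆
    v∉Xu v∈ = indXu c v (p⊆p∪q ⁅ u ⁆ c∈X) v∈ c~v
    by-cases : Dec (Adj G u v) → Overpowers X v
    by-cases (no u≁v) = overpowers-transfer N∩Xu⊆X (offXu v (v∉Xu , c , p⊆p∪q ⁅ u ⁆ c∈X , c~v))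
      where
      N∩Xu⊆X : ∀ z → Adj G v z → z ∈ X ∪ ⁅ u ⁆ → z ∈ X
      N∩Xu⊆X z v~z z∈ with x∈p∪⁅y⁆⁻ X z∈
      ... | inj₁ z∈X  = z∈X
      ... | inj₂ refl = ⊥-elim (u≁v (Adj-sym v~z))
    by-cases (yes u~v) with any? (λ z → (z ∈? D) ×-dec Adj? v z)
    ... | yes (d , d∈D , v~d) =
      overpowers-transfer (λ _ _ → D⊆X) (offD v ((λ v∈D → v∉X (D⊆X v∈D)) , d , d∈D , Adj-sym v~d))
    ... | no  no-d = ⊥-elim (u∉X (subst (_∈ X) c≡u c∈X))
      where
      only-u : ∀ z → Adj G v z → z ∈ D ∪ ⁅ u ⁆ → z ≡ u
      only-u z v~z z∈ with x∈p∪⁅y⁆⁻ D z∈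
      ... | inj₁ z∈D = ⊥-elim (no-d (z , z∈D , v~z))
      ... | inj₂ z≡u = z≡u
      v∉Du : v ∉ D ∪ ⁅ u ⁆
      v∉Du v∈ = v∉Xu (p∪⁅x⁆⊆q (λ d∈D → p⊆p∪q ⁅ u ⁆ (D⊆X d∈D)) x∈p∪⁅x⁆ v∈)
      c≡u : c ≡ u
      c≡u = unique-attacker⇒unique-neighbour offDu (v∉Du , u , x∈p∪⁅x⁆ , u~v) only-u c (Adj-sym c~v)

  tar-detour : ∀ {k} → u ∉ C → w ∉ C → u ≢ w → suc ∣ C ∣ ≡ k →
    IsIOA G (C ∪ ⁅ u ⁆) → IsIOA G (C ∪ ⁅ w ⁆) → IOA-TAR-Seq G (k + 1) (C ∪ ⁅ u ⁆) (C ∪ ⁅ w ⁆)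
  tar-detour {u} {C} {w} {k} u∉C w∉C u≢w 1+∣C∣≡k ioaCu ioaCw = by-cases (Adj? u w)
    where
    1+∣C∣≤ : suc ∣ C ∣ ≤ k + 1
    1+∣C∣≤ = subst (_≤ k + 1) (sym 1+∣C∣≡k) (m≤m+n k 1)
    ∣C∪⁅-⁆∣≤ : ∀ {z} → z ∉ C → ∣ C ∪ ⁅ z ⁆ ∣ ≤ k + 1
    ∣C∪⁅-⁆∣≤ z∉C = subst (_≤ k + 1) (sym (∣p∪⁅x⁆∣≡1+∣p∣ C z∉C)) 1+∣C∣≤
    by-cases : Dec (Adj G u w) → IOA-TAR-Seq G (k + 1) (C ∪ ⁅ u ⁆) (C ∪ ⁅ w ⁆)
    by-cases (yes u~w) =
      step (ioaCu , ∣C∪⁅-⁆∣≤ u∉C) (inj₂ (u , u∉C , refl))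
        (step (ioa-meet u∉C w∉C u≢w u~w ioaCu ioaCw , ≤-trans (n≤1+n ∣ C ∣) 1+∣C∣≤)
              (inj₁ (w , w∉C , refl))
          (single (ioaCw , ∣C∪⁅-⁆∣≤ w∉C)))
    by-cases (no u≁w) =
      step (ioaCu , ∣C∪⁅-⁆∣≤ u∉C) (inj₁ (w , w∉Cu , refl))
        (step (ioa-join u≁w ioaCu ioaCw , ≤-reflexive ∣Cuw∣≡k+1) (inj₂ (u , u∉Cw , Cuw≡Cwu))
          (single (ioaCw , ∣C∪⁅-⁆∣≤ w∉C)))
      where
      w∉Cu : w ∉ C ∪ ⁅ u ⁆
      w∉Cu w∈ = [ w∉C , (λ w≡u → u≢w (sym w≡u)) ]′ (x∈p∪⁅y⁆⁻ C w∈)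
      u∉Cw : u ∉ C ∪ ⁅ w ⁆
      u∉Cw u∈ = [ u∉C , u≢w ]′ (x∈p∪⁅y⁆⁻ C u∈)
      Cuw≡Cwu : (C ∪ ⁅ u ⁆) ∪ ⁅ w ⁆ ≡ (C ∪ ⁅ w ⁆) ∪ ⁅ u ⁆
      Cuw≡Cwu = begin
        (C ∪ ⁅ u ⁆) ∪ ⁅ w ⁆  ≡⟨ ∪-assoc C ⁅ u ⁆ ⁅ w ⁆ ⟩
        C ∪ (⁅ u ⁆ ∪ ⁅ w ⁆)  ≡⟨ cong (C ∪_) (∪-comm ⁅ u ⁆ ⁅ w ⁆) ⟩
        C ∪ (⁅ w ⁆ ∪ ⁅ u ⁆)  ≡⟨ sym (∪-assoc C ⁅ w ⁆ ⁅ u ⁆) ⟩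
        (C ∪ ⁅ w ⁆) ∪ ⁅ u ⁆  ∎
        where open ≡-Reasoning
      ∣Cuw∣≡k+1 : ∣ (C ∪ ⁅ u ⁆) ∪ ⁅ w ⁆ ∣ ≡ k + 1
      ∣Cuw∣≡k+1 = begin
        ∣ (C ∪ ⁅ u ⁆) ∪ ⁅ w ⁆ ∣  ≡⟨ ∣p∪⁅x⁆∣≡1+∣p∣ (C ∪ ⁅ u ⁆) w∉Cu ⟩
        suc ∣ C ∪ ⁅ u ⁆ ∣        ≡⟨ cong suc (∣p∪⁅x⁆∣≡1+∣p∣ C u∉C) ⟩
        suc (suc ∣ C ∣)          ≡⟨ cong suc 1+∣C∣≡k ⟩
        suc k                    ≡⟨ +-comm 1 k ⟩
        k + 1                    ∎
        where open ≡-Reasoning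

  tj⇒tar : ∀ {k} → ∣ A ∣ ≡ k → IOA-TJ-Seq G A B → IOA-TAR-Seq G (k + 1) A B
  tj⇒tar {k = k} ∣A∣≡k (single ioaA) = single (ioaA , ≤-trans (≤-reflexive ∣A∣≡k) (m≤m+n k 1))
  tj⇒tar ∣A∣≡k (step {A} {B} ioaA A→B rest) with tjStep-split {p = A} {q = B} A→B
  ... | C , u , w , u∉C , w∉C , u≢w , refl , refl =
    tar-detour u∉C w∉C u≢w (trans (sym (∣p∪⁅x⁆∣≡1+∣p∣ C u∉C)) ∣A∣≡k) ioaA (first rest)
    ++ˢ tj⇒tar (trans (sym (proj₁ A→B)) ∣A∣≡k) rest

  module _ (As : Subset n) (k : ℕ) where

    Reachable : Subset n → Set
    Reachable S = IOA-TJ-Seq G As S × ∣ S ∣ ≡ k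

    IOA-Interval : Subset n → Subset n → Set
    IOA-Interval D S = ∀ X → D ⊆ X → X ⊆ S → IsIOA G X

    data Anchored (D : Subset n) : Set where
      below : Reachable S → D ⊆ S → IOA-Interval D S → Anchored D
      above : Reachable S → S ⊆ D → ∣ D ∣ ≡ suc k → Anchored D

    anchored-self : Reachable D → Anchored D
    anchored-self reach@(D-seq , _) =
      below reach ⊆-refl (λ X D⊆X X⊆D → subst (IsIOA G) (⊆-antisym D⊆X X⊆D) (last D-seq))

    reachable-drop : Reachable S → S ⊆ D ∪ ⁅ u ⁆ → u ∉ D → ∣ D ∣ ≡ k → IsIOA G D → Reachable D
    reachable-drop {S} {D} {u} (S-seq , ∣S∣≡k) S⊆Du u∉D ∣D∣≡k ioaD with u ∈? S
    ... | yes u∈S = snoc S-seq (tjStep⁺ (trans ∣S∣≡k (sym ∣D∣≡k)) u∈S u∉D S⊆Du) ioaD , ∣D∣≡k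
    ... | no  u∉S = subst (IOA-TJ-Seq G As) S≡D S-seq , ∣D∣≡k
      where
      S⊆D : S ⊆ D
      S⊆D s∈S = [ (λ s∈D → s∈D) , (λ { refl → ⊥-elim (u∉S s∈S) }) ]′ (x∈p∪⁅y⁆⁻ D (S⊆Du s∈S))
      S≡D : S ≡ D
      S≡D = p⊆q∧∣q∣≤∣p∣⇒p≡q S⊆D (≤-reflexive (trans ∣D∣≡k (sym ∣S∣≡k)))

    interval-drop : IOA-Interval (D ∪ ⁅ u ⁆) S → D ∪ ⁅ u ⁆ ⊆ S → IsIOA G D → IOA-Interval D S
    interval-drop {D} {u} {S} interval Du⊆S (_ , offD) X D⊆X X⊆S with u ∈? X
    ... | yes u∈X = interval X (p∪⁅x⁆⊆q D⊆X u∈X) X⊆S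
    ... | no  u∉X =
      independent-⊆ (p⊆p∪q ⁅ u ⁆) (proj₁ ioaXu) ,
      offensive-drop D⊆X u∉X ioaXu (proj₂ (interval (D ∪ ⁅ u ⁆) ⊆-refl Du⊆S)) offD
      where
      Du⊆Xu : D ∪ ⁅ u ⁆ ⊆ X ∪ ⁅ u ⁆
      Du⊆Xu = p∪⁅x⁆⊆q (λ d∈D → p⊆p∪q ⁅ u ⁆ (D⊆X d∈D)) x∈p∪⁅x⁆
      ioaXu : IsIOA G (X ∪ ⁅ u ⁆)
      ioaXu = interval (X ∪ ⁅ u ⁆) Du⊆Xu (p∪⁅x⁆⊆q X⊆S (Du⊆S x∈p∪⁅x⁆))

    anchored-drop : Anchored (D ∪ ⁅ u ⁆) → u ∉ D → IsIOA G D → Anchored D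
    anchored-drop (below reach Du⊆S interval) u∉D ioaD =
      below reach (λ d∈D → Du⊆S (p⊆p∪q _ d∈D)) (interval-drop interval Du⊆S ioaD)
    anchored-drop {D} (above reach S⊆Du ∣Du∣≡1+k) u∉D ioaD =
      anchored-self (reachable-drop reach S⊆Du u∉D ∣D∣≡k ioaD)
      where
      ∣D∣≡k : ∣ D ∣ ≡ k
      ∣D∣≡k = suc-injective (trans (sym (∣p∪⁅x⁆∣≡1+∣p∣ D u∉D)) ∣Du∣≡1+k)

    -- A neighbour w of u in S is unique: D ∪ ⁅w⁆ is an offensive alliance with u on its
    -- boundary and w as u's only neighbour in it.
    exchange-candidate : D ⊆ S → IOA-Interval D S → u ∉ S → IsIndependent G (D ∪ ⁅ u ⁆) →
      (∃ λ w → w ∈ S × w ∉ D × ∀ z → z ∈ S → Adj G u z → z ≡ w) ⊎ S ⊆ D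
    exchange-candidate {D} {S} {u} D⊆S interval u∉S indDu
      with any? (λ z → (z ∈? S) ×-dec Adj? u z)
    ... | yes (w , w∈S , u~w) = inj₁ (w , w∈S , w∉D , λ z _ u~z → only-neighbour z u~z)
      where
      u-isolated-in-D : ∀ z → z ∈ D → ¬ Adj G u z
      u-isolated-in-D z z∈D = indDu u z x∈p∪⁅x⁆ (p⊆p∪q ⁅ u ⁆ z∈D)
      w∉D : w ∉ D
      w∉D w∈D = u-isolated-in-D w w∈D u~w
      Dw⊆S : D ∪ ⁅ w ⁆ ⊆ S
      Dw⊆S = p∪⁅x⁆⊆q D⊆S w∈S
      only-w : ∀ z → Adj G u z → z ∈ D ∪ ⁅ w ⁆ → z ≡ w
      only-w z u~z z∈ = [ (λ z∈D → ⊥-elim (u-isolated-in-D z z∈D u~z)) , (λ z≡w → z≡w) ]′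
        (x∈p∪⁅y⁆⁻ D z∈)
      only-neighbour : ∀ z → Adj G u z → z ≡ w
      only-neighbour = unique-attacker⇒unique-neighbour
        (proj₂ (interval (D ∪ ⁅ w ⁆) (p⊆p∪q ⁅ w ⁆) Dw⊆S))
        ((λ u∈ → u∉S (Dw⊆S u∈)) , w , x∈p∪⁅x⁆ , Adj-sym u~w) only-w
    ... | no no-neighbour with ∃∈q∉p⊎q⊆p D S
    ...   | inj₁ (w , w∈S , w∉D) =
      inj₁ (w , w∈S , w∉D , λ z z∈S u~z → ⊥-elim (no-neighbour (z , z∈S , u~z)))
    ...   | inj₂ S⊆D = inj₂ S⊆D

    interval-exchange : D ⊆ S → IOA-Interval D S → IsOffensiveAlliance G (D ∪ ⁅ u ⁆) → u ∉ S →
      w ∉ D → (∀ z → z ∈ S → Adj G u z → z ≡ w) → IOA-Interval (D ∪ ⁅ u ⁆) ((S - w) ∪ ⁅ u ⁆)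
    interval-exchange {D} {S} {u} {w} D⊆S interval offDu u∉S w∉D only-w X Du⊆X X⊆S′ =
      independent-⊆ X⊆S′ indS′ , offensive-cover cover
      where
      S-w⊆S : S - w ⊆ S
      S-w⊆S = p─q⊆p S ⁅ w ⁆
      u-isolated : ∀ z → z ∈ S - w → ¬ Adj G z u
      u-isolated z z∈ z~u = x∈p─q⇒x∉q S ⁅ w ⁆ z∈
        (subst (_∈ ⁅ w ⁆) (sym (only-w z (S-w⊆S z∈) (Adj-sym z~u))) (x∈⁅x⁆ w))
      indS′ : IsIndependent G ((S - w) ∪ ⁅ u ⁆)
      indS′ = independent-∪⁅⁆ (independent-⊆ S-w⊆S (proj₁ (interval S D⊆S ⊆-refl))) u-isolated
      D⊆X-u : D ⊆ X - u
      D⊆X-u d∈D = x∈p∧x≢y⇒x∈p-y (Du⊆X (p⊆p∪q ⁅ u ⁆ d∈D)) (λ { refl → u∉S (D⊆S d∈D) })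
      X-u⊆S : X - u ⊆ S
      X-u⊆S z∈ with x∈p∪⁅y⁆⁻ (S - w) (X⊆S′ (p─q⊆p X ⁅ u ⁆ z∈))
      ... | inj₁ z∈S-w = S-w⊆S z∈S-w
      ... | inj₂ refl  = ⊥-elim (x∈p─q⇒x∉q X ⁅ u ⁆ z∈ (x∈⁅x⁆ u))
      cover : ∀ c → c ∈ X → ∃ λ A → c ∈ A × A ⊆ X × IsOffensiveAlliance G A
      cover c c∈X with c ≟ᶠ u
      ... | yes refl = D ∪ ⁅ u ⁆ , x∈p∪⁅x⁆ , Du⊆X , offDu
      ... | no  c≢u  = X - u , x∈p∧x≢y⇒x∈p-y c∈X c≢u , p─q⊆p X ⁅ u ⁆ ,
                       proj₂ (interval (X - u) D⊆X-u X-u⊆S)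

    anchored-exchange : D ⊆ S → IOA-Interval D S → Reachable S → IsOffensiveAlliance G (D ∪ ⁅ u ⁆) →
      u ∉ S → w ∈ S → w ∉ D → (∀ z → z ∈ S → Adj G u z → z ≡ w) → Anchored (D ∪ ⁅ u ⁆)
    anchored-exchange {D} {S} {u} {w} D⊆S interval (S-seq , ∣S∣≡k) offDu u∉S w∈S w∉D only-w =
      below (snoc S-seq (tjStep-exchange w∈S u∉S) (interval′ S′ Du⊆S′ ⊆-refl) , ∣S′∣≡k)
            Du⊆S′ interval′
      where
      S′ : Subset n
      S′ = (S - w) ∪ ⁅ u ⁆
      ∣S′∣≡k : ∣ S′ ∣ ≡ k
      ∣S′∣≡k = trans (sym (proj₁ (tjStep-exchange w∈S u∉S))) ∣S∣≡k
      Du⊆S′ : D ∪ ⁅ u ⁆ ⊆ S′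
      Du⊆S′ = p∪⁅x⁆⊆q (λ d∈D → p⊆p∪q ⁅ u ⁆ (x∈p∧x≢y⇒x∈p-y (D⊆S d∈D) (λ { refl → w∉D d∈D })))
                       x∈p∪⁅x⁆
      interval′ : IOA-Interval (D ∪ ⁅ u ⁆) S′
      interval′ = interval-exchange D⊆S interval offDu u∉S w∉D only-w

    anchored-add : Anchored D → u ∉ D → IsIOA G (D ∪ ⁅ u ⁆) → ∣ D ∪ ⁅ u ⁆ ∣ ≤ k + 1 →
      Anchored (D ∪ ⁅ u ⁆)
    anchored-add {D} (above _ _ ∣D∣≡1+k) u∉D _ ∣Du∣≤ =
      ⊥-elim (1+n≰n (subst₂ _≤_ ∣Du∣≡2+k (+-comm k 1) ∣Du∣≤))
      where
      ∣Du∣≡2+k : ∣ D ∪ ⁅ _ ⁆ ∣ ≡ suc (suc k)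
      ∣Du∣≡2+k = trans (∣p∪⁅x⁆∣≡1+∣p∣ D u∉D) (cong suc ∣D∣≡1+k)
    anchored-add {D} {u} (below {S} reach D⊆S interval) u∉D ioaDu _ with u ∈? S
    ... | yes u∈S = below reach (p∪⁅x⁆⊆q D⊆S u∈S)
                      (λ X Du⊆X X⊆S → interval X (λ d∈D → Du⊆X (p⊆p∪q ⁅ u ⁆ d∈D)) X⊆S)
    ... | no  u∉S with exchange-candidate D⊆S interval u∉S (proj₁ ioaDu)
    ...   | inj₁ (w , w∈S , w∉D , only-w) =
      anchored-exchange D⊆S interval reach (proj₂ ioaDu) u∉S w∈S w∉D only-w
    ...   | inj₂ S⊆D = above reach (λ s∈S → p⊆p∪q ⁅ u ⁆ (S⊆D s∈S)) ∣Du∣≡1+k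
      where
      ∣Du∣≡1+k : ∣ D ∪ ⁅ u ⁆ ∣ ≡ suc k
      ∣Du∣≡1+k =
        trans (∣p∪⁅x⁆∣≡1+∣p∣ D u∉D) (cong suc (trans (cong ∣_∣ (⊆-antisym D⊆S S⊆D)) (proj₂ reach)))

    anchored-step : Anchored D → TARStep D B → IsIOA G B × Bounded (k + 1) B → Anchored B
    anchored-step anchored (inj₁ (u , u∉D , refl)) (ioaB , ∣B∣≤) =
      anchored-add anchored u∉D ioaB ∣B∣≤
    anchored-step anchored (inj₂ (u , u∉B , refl)) (ioaB , _) =
      anchored-drop anchored u∉B ioaB

    anchored-along : Anchored D → IOA-TAR-Seq G (k + 1) D B → Anchored B
    anchored-along anchored (single _)        = anchored
    anchored-along anchored (step _ D→D′ rest) =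
      anchored-along (anchored-step anchored D→D′ (first rest)) rest

    anchored-reachable : Anchored D → ∣ D ∣ ≡ k → IOA-TJ-Seq G As D
    anchored-reachable {D} (below {S} (S-seq , ∣S∣≡k) D⊆S _) ∣D∣≡k =
      subst (IOA-TJ-Seq G As) (sym D≡S) S-seq
      where
      D≡S : D ≡ S
      D≡S = p⊆q∧∣q∣≤∣p∣⇒p≡q D⊆S (≤-reflexive (trans ∣S∣≡k (sym ∣D∣≡k)))
    anchored-reachable (above _ _ ∣D∣≡1+k) ∣D∣≡k = ⊥-elim (1+n≢n (trans (sym ∣D∣≡1+k) ∣D∣≡k))

  tar⇒tj : ∀ {k} → IsIOA G A → ∣ A ∣ ≡ k → ∣ B ∣ ≡ k → IOA-TAR-Seq G (k + 1) A B → IOA-TJ-Seq G A B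
  tar⇒tj {A} {k = k} ioaA ∣A∣≡k ∣B∣≡k tar =
    anchored-reachable A k (anchored-along A k (anchored-self A k (single ioaA , ∣A∣≡k)) tar) ∣B∣≡k

theorem4 : ∀ {n} (G : Graph n) (As At : Subset n) (k : ℕ) →
    IsIOA G As → IsIOA G At → ∣ As ∣ ≡ k → ∣ At ∣ ≡ k →
    (IOA-TJ-Seq G As At → IOA-TAR-Seq G (k + 1) As At) ×
    (IOA-TAR-Seq G (k + 1) As At → IOA-TJ-Seq G As At)
theorem4 G As At k ioaAs _ ∣As∣≡k ∣At∣≡k = tj⇒tar G ∣As∣≡k , tar⇒tj G ioaAs ∣As∣≡k ∣At∣≡k
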